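{- Let $L$ be a residuated lattice and $n\geq 1$ an integer. The following conditions are equivalent: (i) $L$ is an $n$-fold positive implicative residuated lattice; (ii) every filter of $L$ is an $n$-fold positive implicative filter of $L$; (iii) $\{1\}$ is an $n$-fold positive implicative filter of $L$.
   Context: A residuated lattice is an algebra $(L,\wedge,\vee,\otimes,\rightarrow,0,1)$ such that $(L,\wedge,\vee,0,1)$ is a bounded lattice, $(L,\otimes,1)$ is a commutative monoid, and $x\otimes y\leq z$ iff $x\leq y\rightarrow z$. A filter of $L$ is a nonempty subset closed under $\otimes$ and upward closed. For $x\in L$, $\overline{x}=x\rightarrow 0$ and $x^n=x\otimes\cdots\otimes x$ ($n$ factors). $L$ is an $n$-fold positive implicative residuated lattice if $\overline{y^n}\rightarrow y=y$ for every $y\in L$. A subset $F\subseteq L$ is an $n$-fold positive implicative filter if $1\in F$ and for all $x,y,z\in L$: $x\rightarrow((y^n\rightarrow z)\rightarrow y)\in F$ and $x\in F$ imply $y\in F$. -}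

module Defs where

open import Level using (Level; suc; _⊔_)
open import Data.Nat using (ℕ; zero)
import Data.Nat as ℕ
open import Data.Product using (_×_; ∃)
open import Function.Bundles using (_⇔_)
open import Relation.Binary.PropositionalEquality using (_≡_)
open import Algebra.Core using (Op₂)
open import Algebra.Structures using (IsCommutativeMonoid)
open import Algebra.Lattice.Structures using (IsLattice)

record ResiduatedLattice (c : Level) : Set (suc c) where
  infixr 5 _⇒_
  infixl 7 _⊗_
  infixr 6 _∧_
  infixr 6 _∨_
  infix 4 _≤_
  field
    Carrier  : Set c
    _∧_      : Op₂ Carrier
    _∨_      : Op₂ Carrier
    _⊗_      : Op₂ Carrier
    _⇒_      : Op₂ Carrier
    𝟘        : Carrier
    𝟙        : Carrier
    isLattice : IsLattice {A = Carrier} _≡_ _∨_ _∧_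
  _≤_ : Carrier → Carrier → Set c
  x ≤ y = x ∧ y ≡ x
  field
    𝟘-least   : ∀ x → 𝟘 ≤ x
    𝟙-greatest : ∀ x → x ≤ 𝟙
    isCommutativeMonoid : IsCommutativeMonoid {A = Carrier} _≡_ _⊗_ 𝟙
    residuation : ∀ x y z → (x ⊗ y ≤ z) ⇔ (x ≤ y ⇒ z)

module _ {c : Level} (L : ResiduatedLattice c) where
  open ResiduatedLattice L

  ¬′ : Carrier → Carrier
  ¬′ x = x ⇒ 𝟘

  pow : Carrier → ℕ → Carrier
  pow x zero = 𝟙
  pow x (ℕ.suc n) = x ⊗ pow x n

  IsFilter : (Carrier → Set c) → Set c
  IsFilter F = ∃ F × (∀ x y → F x → F y → F (x ⊗ y))
                   × (∀ x y → F x → x ≤ y → F y)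

  IsNFoldPosImplRL : ℕ → Set c
  IsNFoldPosImplRL n = ∀ y → (¬′ (pow y n) ⇒ y) ≡ y

  IsNFoldPosImplFilter : ℕ → (Carrier → Set c) → Set c
  IsNFoldPosImplFilter n F =
    F 𝟙 × (∀ x y z → F (x ⇒ ((pow y n ⇒ z) ⇒ y)) → F x → F y)

-- For (i) ⇒ (ii): since z ≥ 0 and → is antitone in its first argument,
-- (yⁿ → z) → y ≤ ȳⁿ → y = y, so a filter containing x and x → ((yⁿ → z) → y)
-- contains (yⁿ → z) → y by modus ponens, hence y.  For (iii) ⇒ (i): with
-- a = ȳⁿ → y and Y = a → y we have y ≤ Y, so Ȳⁿ ≤ ȳⁿ and a ⊗ Ȳⁿ ≤ y, i.e.
-- Ȳⁿ ≤ Y.  The filter condition for {1} at x = 1, z = 0 then forces Y = 1,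
-- that is a ≤ y; the reverse inequality y ≤ a → y holds in every residuated
-- lattice.
module Submission where

open import Defs
open import Level using (Level)
open import Data.Nat using (ℕ; _≥_; zero; suc)
open import Data.Product using (_×_; _,_)
open import Function.Bundles using (_⇔_; mk⇔; Equivalence)
open import Relation.Binary.PropositionalEquality using (_≡_; refl; sym; subst)
open import Relation.Binary.Bundles using (Poset)
open import Relation.Binary.Structures using (IsPartialOrder)
open import Algebra.Structures using (IsCommutativeMonoid)
open import Algebra.Lattice.Bundles using (Lattice)
import Algebra.Lattice.Properties.Lattice as LatticeProperties
import Relation.Binary.Reasoning.PartialOrder as PosetReasoning

module ResiduatedLatticeProperties {c : Level} (L : ResiduatedLattice c) where
  open ResiduatedLattice L
  open IsCommutativeMonoid isCommutativeMonoid using (comm; identityˡ; identityʳ)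

  private
    lattice : Lattice c c
    lattice = record { isLattice = isLattice }

    open LatticeProperties lattice using (∧-idem; poset)
    -- The library's natural order is x ≈ x ∧ y, the converse equation of _≤_.
    module ∧-Order = Poset poset

  ≤-isPartialOrder : IsPartialOrder _≡_ _≤_
  ≤-isPartialOrder = record
    { isPreorder = record
      { isEquivalence = ∧-Order.isEquivalence
      ; reflexive     = λ { refl → ∧-idem _ }
      ; trans         = λ p q → sym (∧-Order.trans (sym p) (sym q))
      }
    ; antisym = λ p q → ∧-Order.antisym (sym p) (sym q)
    }

  ≤-poset : Poset c c c
  ≤-poset = record { isPartialOrder = ≤-isPartialOrder }

  open Poset ≤-poset public using (reflexive; antisym)
    renaming (refl to ≤-refl; trans to ≤-trans)
  module ≤-Reasoning = PosetReasoning ≤-poset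

  residual-intro : ∀ {x y z} → x ⊗ y ≤ z → x ≤ y ⇒ z
  residual-intro {x} {y} {z} = Equivalence.to (residuation x y z)

  residual-elim : ∀ {x y z} → x ≤ y ⇒ z → x ⊗ y ≤ z
  residual-elim {x} {y} {z} = Equivalence.from (residuation x y z)

  x⊗[x⇒y]≤y : ∀ x y → x ⊗ (x ⇒ y) ≤ y
  x⊗[x⇒y]≤y x y = subst (_≤ y) (comm (x ⇒ y) x) (residual-elim ≤-refl)

  ⊗-monoʳ-≤ : ∀ x {y z} → y ≤ z → x ⊗ y ≤ x ⊗ z
  ⊗-monoʳ-≤ x {y} {z} y≤z = subst (_≤ x ⊗ z) (comm y x)
    (residual-elim (≤-trans y≤z (residual-intro (reflexive (comm z x)))))

  ⊗-monoˡ-≤ : ∀ x {y z} → y ≤ z → y ⊗ x ≤ z ⊗ x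
  ⊗-monoˡ-≤ x {y} {z} y≤z
    rewrite comm y x | comm z x = ⊗-monoʳ-≤ x y≤z

  ⊗-mono-≤ : ∀ {w x y z} → w ≤ x → y ≤ z → w ⊗ y ≤ x ⊗ z
  ⊗-mono-≤ {x = x} {y} w≤x y≤z = ≤-trans (⊗-monoˡ-≤ y w≤x) (⊗-monoʳ-≤ x y≤z)

  ⇒-monoʳ-≤ : ∀ x {y z} → y ≤ z → x ⇒ y ≤ x ⇒ z
  ⇒-monoʳ-≤ x y≤z = residual-intro (≤-trans (residual-elim ≤-refl) y≤z)

  ⇒-antimonoˡ-≤ : ∀ z {x y} → x ≤ y → y ⇒ z ≤ x ⇒ z
  ⇒-antimonoˡ-≤ z {y = y} x≤y =
    residual-intro (≤-trans (⊗-monoʳ-≤ (y ⇒ z) x≤y) (residual-elim ≤-refl))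

  pow-mono-≤ : ∀ n {x y} → x ≤ y → pow L x n ≤ pow L y n
  pow-mono-≤ zero    x≤y = ≤-refl
  pow-mono-≤ (suc n) x≤y = ⊗-mono-≤ x≤y (pow-mono-≤ n x≤y)

  y≤x⇒y : ∀ x y → y ≤ x ⇒ y
  y≤x⇒y x y = residual-intro (subst (y ⊗ x ≤_) (identityʳ y) (⊗-monoʳ-≤ y (𝟙-greatest x)))

  ⇒≡𝟙⇔≤ : ∀ {x y} → x ⇒ y ≡ 𝟙 ⇔ x ≤ y
  ⇒≡𝟙⇔≤ {x} {y} = mk⇔
    (λ x⇒y≡𝟙 → subst (_≤ y) (identityˡ x)
                 (residual-elim (reflexive (sym x⇒y≡𝟙))))
    (λ x≤y → antisym (𝟙-greatest _)
               (residual-intro (subst (_≤ y) (sym (identityˡ x)) x≤y)))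

module FilterProperties {c : Level} (L : ResiduatedLattice c) where
  open ResiduatedLattice L
  open IsCommutativeMonoid isCommutativeMonoid using (identityʳ)
  open ResiduatedLatticeProperties L

  filter-𝟙 : ∀ {F} → IsFilter L F → F 𝟙
  filter-𝟙 ((w , Fw) , _ , upward) = upward w 𝟙 Fw (𝟙-greatest w)

  filter-mp : ∀ {F} → IsFilter L F → ∀ {x y} → F x → F (x ⇒ y) → F y
  filter-mp (_ , closed , upward) {x} {y} Fx Fx⇒y =
    upward _ y (closed x (x ⇒ y) Fx Fx⇒y) (x⊗[x⇒y]≤y x y)

  𝟙-isFilter : IsFilter L (_≡ 𝟙)
  𝟙-isFilter = (𝟙 , refl)
             , (λ { _ _ refl refl → identityʳ 𝟙 })
             , (λ { _ _ refl 𝟙≤y → antisym (𝟙-greatest _) 𝟙≤y })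

module _ {c : Level} (L : ResiduatedLattice c) (n : ℕ) where
  open ResiduatedLattice L
  open IsCommutativeMonoid isCommutativeMonoid using (comm)
  open ResiduatedLatticeProperties L
  open FilterProperties L

  nFoldPosImplRL⇒filter : IsNFoldPosImplRL L n →
    ∀ {F} → IsFilter L F → IsNFoldPosImplFilter L n F
  nFoldPosImplRL⇒filter ȳⁿ⇒y≡y isFilter@(_ , _ , upward) =
    filter-𝟙 isFilter ,
    λ x y z Fx⇒[[yⁿ⇒z]⇒y] Fx →
      upward _ y (filter-mp isFilter Fx Fx⇒[[yⁿ⇒z]⇒y]) ([yⁿ⇒z]⇒y≤y y z)
    where
    [yⁿ⇒z]⇒y≤y : ∀ y z → (pow L y n ⇒ z) ⇒ y ≤ y
    [yⁿ⇒z]⇒y≤y y z = subst ((pow L y n ⇒ z) ⇒ y ≤_) (ȳⁿ⇒y≡y y)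
      (⇒-antimonoˡ-≤ y (⇒-monoʳ-≤ (pow L y n) (𝟘-least z)))

  𝟙-nFoldPosImplFilter⇒nFoldPosImplRL :
    IsNFoldPosImplFilter L n (_≡ 𝟙) → IsNFoldPosImplRL L n
  𝟙-nFoldPosImplFilter⇒nFoldPosImplRL (_ , condition) y =
    antisym a≤y (y≤x⇒y (¬′ L (pow L y n)) y)
    where
    a Y : Carrier
    a = ¬′ L (pow L y n) ⇒ y
    Y = a ⇒ y

    Ȳⁿ≤Y : ¬′ L (pow L Y n) ≤ Y
    Ȳⁿ≤Y = residual-intro (begin
      ¬′ L (pow L Y n) ⊗ a  ≡⟨ comm _ a ⟩
      a ⊗ ¬′ L (pow L Y n)  ≤⟨ ⊗-monoʳ-≤ a (⇒-antimonoˡ-≤ 𝟘 (pow-mono-≤ n (y≤x⇒y a y))) ⟩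
      a ⊗ ¬′ L (pow L y n)  ≤⟨ residual-elim ≤-refl ⟩
      y                     ∎)
      where open ≤-Reasoning

    Y≡𝟙 : Y ≡ 𝟙
    Y≡𝟙 = condition 𝟙 Y 𝟘
      (Equivalence.from ⇒≡𝟙⇔≤ (reflexive (sym (Equivalence.from ⇒≡𝟙⇔≤ Ȳⁿ≤Y))))
      refl

    a≤y : a ≤ y
    a≤y = Equivalence.to ⇒≡𝟙⇔≤ Y≡𝟙

-- The argument does not use the hypothesis n ≥ 1.
proposition5p14 : ∀ {c : Level} (L : ResiduatedLattice c) (n : ℕ) → n ≥ 1 →
    (IsNFoldPosImplRL L n ⇔ (∀ (F : ResiduatedLattice.Carrier L → Set c) → IsFilter L F → IsNFoldPosImplFilter L n F))
    × (IsNFoldPosImplRL L n ⇔ IsNFoldPosImplFilter L n (λ x → x ≡ ResiduatedLattice.𝟙 L))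
proposition5p14 L n _ =
    mk⇔ (λ i F → nFoldPosImplRL⇒filter L n i)
        (λ ii → 𝟙-nFoldPosImplFilter⇒nFoldPosImplRL L n (ii _ 𝟙-isFilter))
  , mk⇔ (λ i → nFoldPosImplRL⇒filter L n i 𝟙-isFilter)
        (𝟙-nFoldPosImplFilter⇒nFoldPosImplRL L n)
  where open FilterProperties L using (𝟙-isFilter)
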